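{- Let $X$ be a set with two ternary relations $R,S$ and let $(Q,\le,\bullet,\diamond)$ be a bi-prequantale. For each $1\le k\le 7$, let $j(k)=1$ if $k\in\{1,2\}$, $j(k)=2$ if $k\in\{3,5\}$, $j(k)=3$ if $k\in\{4,6\}$, $j(k)=4$ if $k=7$. If $(RD_{j(k)})$ holds in $X$ and $(I_k)$ holds in $Q^X$ (with $\bullet$ interpreted as convolution $\ast$ and $\diamond$ as convolution $\circledast$, order pointwise), then $(I_k)$ holds in $Q$.
   Context: $R^x_{yz}$ means $R$ holds at $(x,y,z)$. Bi-prequantale: complete lattice with two binary operations $\bullet,\diamond$ each preserving arbitrary sups in both arguments. Convolutions: $(f\ast g)(x)=\bigvee\{f(y)\bullet g(z)\mid R^x_{yz}\}$, $(f\circledast g)(x)=\bigvee\{f(y)\diamond g(z)\mid S^x_{yz}\}$. Nondegeneracy conditions on $X$: $(RD_1)$ $\exists x,u,v.\ R^x_{uv}$; $(RD_2)$ $\exists x,y,u,v,w.\ R^x_{uy}\wedge S^y_{vw}$; $(RD_3)$ $\exists x,y,u,v,w.\ S^y_{uv}\wedge R^x_{yw}$; $(RD_4)$ $\exists x,y,z,t,u,v,w.\ S^y_{tu}\wedge R^x_{yz}\wedge S^z_{vw}$. Algebraic interchange laws (for all $a,b,c,d$): $(I_1)$ $a\bullet b\le a\diamond b$; $(I_2)$ $a\bullet b\le b\diamond a$; $(I_3)$ $a\bullet(b\diamond c)\le(a\bullet b)\diamond c$; $(I_4)$ $(a\diamond b)\bullet c\le a\diamond(b\bullet c)$; $(I_5)$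 $a\bullet(b\diamond c)\le b\diamond(a\bullet c)$; $(I_6)$ $(a\diamond b)\bullet c\le(a\bullet c)\diamond b$; $(I_7)$ $(a\diamond b)\bullet(c\diamond d)\le(a\bullet c)\diamond(b\bullet d)$. -}

module Defs where

open import Level using (Level; _⊔_; suc)
open import Data.Product using (Σ; ∃; _×_; _,_)
open import Relation.Binary.PropositionalEquality using (_≡_)

-- Ternary relation on X; R x y z  stands for  R^x_{yz}.
TernRel : ∀ {ℓ} → Set ℓ → Set (suc ℓ)
TernRel {ℓ} X = X → X → X → Set ℓ

record BiPrequantale (c ℓ : Level) : Set (suc (c ⊔ ℓ)) where
  field
    Carrier : Set c
    _≤_     : Carrier → Carrier → Set ℓ
    ≤-refl  : ∀ {a} → a ≤ a
    ≤-trans : ∀ {a b d} → a ≤ b → b ≤ d → a ≤ d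
    ≤-antisym : ∀ {a b} → a ≤ b → b ≤ a → a ≡ b
    ⋁       : {I : Set ℓ} → (I → Carrier) → Carrier
    ⋁-upper : ∀ {I : Set ℓ} (f : I → Carrier) (i : I) → f i ≤ ⋁ f
    ⋁-least : ∀ {I : Set ℓ} (f : I → Carrier) (b : Carrier) →
              (∀ i → f i ≤ b) → ⋁ f ≤ b
    _•_     : Carrier → Carrier → Carrier
    _◇_     : Carrier → Carrier → Carrier
    •-⋁ˡ    : ∀ {I : Set ℓ} (f : I → Carrier) (b : Carrier) →
              (⋁ f • b) ≡ ⋁ (λ i → f i • b)
    •-⋁ʳ    : ∀ {I : Set ℓ} (a : Carrier) (f : I → Carrier) →
              (a • ⋁ f) ≡ ⋁ (λ i → a • f i)
    ◇-⋁ˡ    : ∀ {I : Set ℓ} (f : I → Carrier) (b : Carrier) →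
              (⋁ f ◇ b) ≡ ⋁ (λ i → f i ◇ b)
    ◇-⋁ʳ    : ∀ {I : Set ℓ} (a : Carrier) (f : I → Carrier) →
              (a ◇ ⋁ f) ≡ ⋁ (λ i → a ◇ f i)

data Law : Set where
  I₁ I₂ I₃ I₄ I₅ I₆ I₇ : Law

Holds : ∀ {a r} {A : Set a} → (A → A → Set r) →
        (A → A → A) → (A → A → A) → Law → Set (a ⊔ r)
Holds _≤_ _•_ _◇_ I₁ = ∀ a b → (a • b) ≤ (a ◇ b)
Holds _≤_ _•_ _◇_ I₂ = ∀ a b → (a • b) ≤ (b ◇ a)
Holds _≤_ _•_ _◇_ I₃ = ∀ a b c → (a • (b ◇ c)) ≤ ((a • b) ◇ c)
Holds _≤_ _•_ _◇_ I₄ = ∀ a b c → ((a ◇ b) • c) ≤ (a ◇ (b • c))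
Holds _≤_ _•_ _◇_ I₅ = ∀ a b c → (a • (b ◇ c)) ≤ (b ◇ (a • c))
Holds _≤_ _•_ _◇_ I₆ = ∀ a b c → ((a ◇ b) • c) ≤ ((a • c) ◇ b)
Holds _≤_ _•_ _◇_ I₇ = ∀ a b c d → ((a ◇ b) • (c ◇ d)) ≤ ((a • c) ◇ (b • d))

data Deg : Set where
  RD₁ RD₂ RD₃ RD₄ : Deg

NonDeg : ∀ {ℓ} {X : Set ℓ} → TernRel X → TernRel X → Deg → Set ℓ
NonDeg {X = X} R S RD₁ = Σ X λ x → Σ X λ u → Σ X λ v → R x u v
NonDeg {X = X} R S RD₂ = Σ X λ x → Σ X λ y → Σ X λ u → Σ X λ v → Σ X λ w →
  R x u y × S y v w
NonDeg {X = X} R S RD₃ = Σ X λ x → Σ X λ y → Σ X λ u → Σ X λ v → Σ X λ w →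
  S y u v × R x y w
NonDeg {X = X} R S RD₄ = Σ X λ x → Σ X λ y → Σ X λ z → Σ X λ t → Σ X λ u →
  Σ X λ v → Σ X λ w → S y t u × R x y z × S z v w

j : Law → Deg
j I₁ = RD₁
j I₂ = RD₁
j I₃ = RD₂
j I₅ = RD₂
j I₄ = RD₃
j I₆ = RD₃
j I₇ = RD₄

module _ {c ℓ} (Q : BiPrequantale c ℓ) {X : Set ℓ} where
  open BiPrequantale Q

  _≤̇_ : (X → Carrier) → (X → Carrier) → Set (ℓ)
  f ≤̇ g = ∀ x → f x ≤ g x

  conv : TernRel X → (Carrier → Carrier → Carrier) →
         (X → Carrier) → (X → Carrier) → (X → Carrier)
  conv T _·_ f g x = ⋁ {I = Σ X λ y → Σ X λ z → T x y z}
                       (λ { (y , z , _) → f y · g z })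

module Submission where

-- Proof idea (reflection of interchange laws along point masses).
-- For u : X and a : Q let  δ u a  be the function X → Q that is a at u and
-- ⊥ elsewhere.  Two elementary facts about convolution drive everything:
--   * lower bound: if T x y z, then  f y · g z ≤ (f ⋆ g) x  (one summand of the sup);
--   * upper bound: if f ≤ a and g ≤ b everywhere, then  f ⋆ g ≤ a · b  everywhere.
-- Both need only that • and ◇ are monotone, which follows from their preserving
-- binary joins.  Given a law (I_k) in Q^X and elements of Q, instantiate the law
-- with point masses at the points supplied by (RD_{j(k)}): the nondegeneracy
-- witness makes the left-hand side of (I_k) in Q a lower bound of the left-hand
-- convolution term at x, and the right-hand side of (I_k) in Q bounds the
-- right-hand convolution term everywhere; the law in Q^X links the two.

open import Defs
open import Level using (Lift; lift; _⊔_)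
open import Data.Bool using (Bool; true; false)
open import Data.Product using (_,_)
open import Relation.Binary.PropositionalEquality using (_≡_; refl; sym; cong)

module Monotonicity {c ℓ} (Q : BiPrequantale c ℓ) where
  open BiPrequantale Q

  ≡⇒≤ : ∀ {a b} → a ≡ b → a ≤ b
  ≡⇒≤ refl = ≤-refl

  pair : Carrier → Carrier → Lift ℓ Bool → Carrier
  pair a b (lift false) = a
  pair a b (lift true)  = b

  _∨_ : Carrier → Carrier → Carrier
  a ∨ b = ⋁ (pair a b)

  ∨-absorb : ∀ {a b} → a ≤ b → (a ∨ b) ≡ b
  ∨-absorb a≤b = ≤-antisym
    (⋁-least _ _ λ { (lift false) → a≤b ; (lift true) → ≤-refl })
    (⋁-upper _ (lift true))

  -- An operation preserving sups in its left argument is monotone there: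
  -- op a b ≤ ⋁ {op a b , op a' b} = op (a ∨ a') b = op a' b.
  monoˡ : (op : Carrier → Carrier → Carrier) →
          (∀ {I : Set ℓ} (f : I → Carrier) b → op (⋁ f) b ≡ ⋁ (λ i → op (f i) b)) →
          ∀ {a a' b} → a ≤ a' → op a b ≤ op a' b
  monoˡ op pres {a} {a'} {b} a≤a' =
    ≤-trans (⋁-upper (λ i → op (pair a a' i) b) (lift false))
      (≤-trans (≡⇒≤ (sym (pres (pair a a') b))) (≡⇒≤ (cong (λ t → op t b) (∨-absorb a≤a'))))

  monoʳ : (op : Carrier → Carrier → Carrier) →
          (∀ {I : Set ℓ} a (f : I → Carrier) → op a (⋁ f) ≡ ⋁ (λ i → op a (f i))) →
          ∀ {a b b'} → b ≤ b' → op a b ≤ op a b'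
  monoʳ op pres {a} {b} {b'} b≤b' =
    ≤-trans (⋁-upper (λ i → op a (pair b b' i)) (lift false))
      (≤-trans (≡⇒≤ (sym (pres a (pair b b')))) (≡⇒≤ (cong (op a) (∨-absorb b≤b'))))

  Monotone₂ : (Carrier → Carrier → Carrier) → Set (c ⊔ ℓ)
  Monotone₂ op = ∀ {a a' b b'} → a ≤ a' → b ≤ b' → op a b ≤ op a' b'

  •-mono : Monotone₂ _•_
  •-mono p q = ≤-trans (monoˡ _•_ •-⋁ˡ p) (monoʳ _•_ •-⋁ʳ q)

  ◇-mono : Monotone₂ _◇_
  ◇-mono p q = ≤-trans (monoˡ _◇_ ◇-⋁ˡ p) (monoʳ _◇_ ◇-⋁ʳ q)

module PointMasses {c ℓ} (Q : BiPrequantale c ℓ) {X : Set ℓ} where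
  open BiPrequantale Q
  open Monotonicity Q using (Monotone₂)

  Bounded : (X → Carrier) → Carrier → Set ℓ
  Bounded f a = ∀ y → f y ≤ a

  δ : X → Carrier → X → Carrier
  δ u a y = ⋁ {I = y ≡ u} (λ _ → a)

  δ-peak : ∀ u a → a ≤ δ u a u
  δ-peak u a = ⋁-upper (λ _ → a) refl

  δ-bounded : ∀ u a → Bounded (δ u a) a
  δ-bounded u a y = ⋁-least _ _ (λ _ → ≤-refl)

  module _ (T : TernRel X) {op : Carrier → Carrier → Carrier} (mono : Monotone₂ op) where

    conv-lower : ∀ {f g a b x y z} → T x y z → a ≤ f y → b ≤ g z →
                 op a b ≤ conv Q T op f g x
    conv-lower {f} {g} {y = y} {z} t a≤fy b≤gz =
      ≤-trans (mono a≤fy b≤gz) (⋁-upper (λ { (y , z , _) → op (f y) (g z) }) (y , z , t))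

    conv-bounded : ∀ {f g a b} → Bounded f a → Bounded g b → Bounded (conv Q T op f g) (op a b)
    conv-bounded f≤a g≤b x = ⋁-least _ _ λ { (y , z , _) → mono (f≤a y) (g≤b z) }

  transfer : ∀ {F G : X → Carrier} {a b} x → a ≤ F x → _≤̇_ Q F G → Bounded G b → a ≤ b
  transfer x a≤Fx F≤G G≤b = ≤-trans a≤Fx (≤-trans (F≤G x) (G≤b x))

module Reflection {c ℓ} (Q : BiPrequantale c ℓ) {X : Set ℓ} (R S : TernRel X) where
  open BiPrequantale Q
  open Monotonicity Q using (•-mono; ◇-mono)
  open PointMasses Q {X}

  _∗_ _⊛_ : (X → Carrier) → (X → Carrier) → X → Carrier
  _∗_ = conv Q R _•_
  _⊛_ = conv Q S _◇_

  ∗-lower : ∀ {f g a b x y z} → R x y z → a ≤ f y → b ≤ g z → (a • b) ≤ (f ∗ g) x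
  ∗-lower = conv-lower R •-mono

  ⊛-lower : ∀ {f g a b x y z} → S x y z → a ≤ f y → b ≤ g z → (a ◇ b) ≤ (f ⊛ g) x
  ⊛-lower = conv-lower S ◇-mono

  ∗-bounded : ∀ {f g a b} → Bounded f a → Bounded g b → Bounded (f ∗ g) (a • b)
  ∗-bounded = conv-bounded R •-mono

  ⊛-bounded : ∀ {f g a b} → Bounded f a → Bounded g b → Bounded (f ⊛ g) (a ◇ b)
  ⊛-bounded = conv-bounded S ◇-mono

  LawInQ LawInQ^X : Law → Set (c ⊔ ℓ)
  LawInQ   = Holds _≤_ _•_ _◇_
  LawInQ^X = Holds (_≤̇_ Q {X}) _∗_ _⊛_

  reflect-I₁ : NonDeg R S RD₁ → LawInQ^X I₁ → LawInQ I₁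
  reflect-I₁ (x , u , v , r) law a b =
    transfer x (∗-lower r (δ-peak u a) (δ-peak v b)) (law (δ u a) (δ v b))
      (⊛-bounded (δ-bounded u a) (δ-bounded v b))

  reflect-I₂ : NonDeg R S RD₁ → LawInQ^X I₂ → LawInQ I₂
  reflect-I₂ (x , u , v , r) law a b =
    transfer x (∗-lower r (δ-peak u a) (δ-peak v b)) (law (δ u a) (δ v b))
      (⊛-bounded (δ-bounded v b) (δ-bounded u a))

  reflect-I₃ : NonDeg R S RD₂ → LawInQ^X I₃ → LawInQ I₃
  reflect-I₃ (x , _ , u , v , w , r , s) law a b c =
    transfer x (∗-lower r (δ-peak u a) (⊛-lower s (δ-peak v b) (δ-peak w c)))
      (law (δ u a) (δ v b) (δ w c))
      (⊛-bounded (∗-bounded (δ-bounded u a) (δ-bounded v b)) (δ-bounded w c))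

  reflect-I₄ : NonDeg R S RD₃ → LawInQ^X I₄ → LawInQ I₄
  reflect-I₄ (x , _ , u , v , w , s , r) law a b c =
    transfer x (∗-lower r (⊛-lower s (δ-peak u a) (δ-peak v b)) (δ-peak w c))
      (law (δ u a) (δ v b) (δ w c))
      (⊛-bounded (δ-bounded u a) (∗-bounded (δ-bounded v b) (δ-bounded w c)))

  reflect-I₅ : NonDeg R S RD₂ → LawInQ^X I₅ → LawInQ I₅
  reflect-I₅ (x , _ , u , v , w , r , s) law a b c =
    transfer x (∗-lower r (δ-peak u a) (⊛-lower s (δ-peak v b) (δ-peak w c)))
      (law (δ u a) (δ v b) (δ w c))
      (⊛-bounded (δ-bounded v b) (∗-bounded (δ-bounded u a) (δ-bounded w c)))

  reflect-I₆ : NonDeg R S RD₃ → LawInQ^X I₆ → LawInQ I₆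
  reflect-I₆ (x , _ , u , v , w , s , r) law a b c =
    transfer x (∗-lower r (⊛-lower s (δ-peak u a) (δ-peak v b)) (δ-peak w c))
      (law (δ u a) (δ v b) (δ w c))
      (⊛-bounded (∗-bounded (δ-bounded u a) (δ-bounded w c)) (δ-bounded v b))

  reflect-I₇ : NonDeg R S RD₄ → LawInQ^X I₇ → LawInQ I₇
  reflect-I₇ (x , _ , _ , t , u , v , w , s₁ , r , s₂) law a b c d =
    transfer x
      (∗-lower r (⊛-lower s₁ (δ-peak t a) (δ-peak u b)) (⊛-lower s₂ (δ-peak v c) (δ-peak w d)))
      (law (δ t a) (δ u b) (δ v c) (δ w d))
      (⊛-bounded (∗-bounded (δ-bounded t a) (δ-bounded v c))
                 (∗-bounded (δ-bounded u b) (δ-bounded w d)))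

proposition3p8 : ∀ {c ℓ} (Q : BiPrequantale c ℓ) {X : Set ℓ} (R S : TernRel X)
    (k : Law) → NonDeg R S (j k) →
    Holds (_≤̇_ Q {X}) (conv Q R (BiPrequantale._•_ Q)) (conv Q S (BiPrequantale._◇_ Q)) k →
    Holds (BiPrequantale._≤_ Q) (BiPrequantale._•_ Q) (BiPrequantale._◇_ Q) k
proposition3p8 Q R S I₁ = reflect-I₁ where open Reflection Q R S
proposition3p8 Q R S I₂ = reflect-I₂ where open Reflection Q R S
proposition3p8 Q R S I₃ = reflect-I₃ where open Reflection Q R S
proposition3p8 Q R S I₄ = reflect-I₄ where open Reflection Q R S
proposition3p8 Q R S I₅ = reflect-I₅ where open Reflection Q R S
proposition3p8 Q R S I₆ = reflect-I₆ where open Reflection Q R S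
proposition3p8 Q R S I₇ = reflect-I₇ where open Reflection Q R S
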